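{- Let $r\ge1$ be an integer. Define numbers $q_1,\dots,q_{r+2}$ by $q_{r+2}=F^{(r)}_2$ and, for $k=1,\dots,r+1$, $$q_{r+2-k}=F^{(r)}_{k+2}-\sum_{j=1}^{k}F^{(r)}_{k+2-j}\,q_{r+3-j}$$ (i.e. $q_{r+1}=F^{(r)}_3-F^{(r)}_2q_{r+2}$, $q_r=F^{(r)}_4-F^{(r)}_3q_{r+2}-F^{(r)}_2q_{r+1}$, ..., $q_1=F^{(r)}_{r+3}-F^{(r)}_{r+2}q_{r+2}-\cdots-F^{(r)}_2q_2$). Let $Q_{r+2}$ be the $(r+2)\times(r+2)$ matrix with $(Q_{r+2})_{i,i+1}=1$ for $1\le i\le r+1$, last row $(q_1,q_2,\dots,q_{r+2})$, and all other entries $0$. For an integer $n$, let $A_{r,n}$ be the $(r+2)\times(r+2)$ matrix with entries $(A_{r,n})_{i,j}=F^{(r)}_{n+i+j-2}$. Then for every integer $n\ge0$, $$A_{r,n}=Q_{r+2}^{\,n}A_{r,0}.$$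
   Context: Let $(F_k)_{k\ge0}$ be the Fibonacci numbers, $F_0=0$, $F_1=1$, $F_{k+2}=F_{k+1}+F_k$. The hyperfibonacci numbers are defined for $k\ge 0$ by $F^{(0)}_k=F_k$ and, for $r\ge1$, $F^{(r)}_k=\sum_{j=0}^{k}F^{(r-1)}_j$ (so $F^{(r)}_0=0$, $F^{(r)}_1=1$). -}

module Defs where

open import Data.Nat using (ℕ; zero; suc; _+_; _∸_)
open import Data.Integer as ℤ using (ℤ; +_)
open import Data.Fin using (Fin; toℕ; fromℕ)
open import Data.List using (map; upTo)
open import Data.Nat.ListAction using (sum)
open import Data.Vec using (Vec; []; _∷_; _∷ʳ_; lookup; last)
open import Relation.Nullary using (yes; no)
open import Data.Nat using (_≟_)

fib : ℕ → ℕ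
fib zero = 0
fib (suc zero) = 1
fib (suc (suc k)) = fib (suc k) + fib k

hyp : ℕ → ℕ → ℕ
hyp zero k = fib k
hyp (suc r) k = sum (map (hyp r) (upTo (suc k)))

F : ℕ → ℕ → ℤ
F r k = + hyp r k

ΣFin : (n : ℕ) → (Fin n → ℤ) → ℤ
ΣFin zero f = + 0
ΣFin (suc n) f = f Fin.zero ℤ.+ ΣFin n (λ i → f (Fin.suc i))

-- pVec r k = [p_0, ..., p_k] where p_k = q_{r+2-k}, i.e.
-- p_0 = F^(r)_2 and
-- p_k = F^(r)_{k+2} - Σ_{j=1}^{k} F^(r)_{k+2-j} p_{j-1}
pVec : ℕ → (k : ℕ) → Vec ℤ (suc k)
pVec r zero = F r 2 ∷ []
pVec r (suc k) =
  let v = pVec r k in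
  v ∷ʳ (F r (k + 3) ℤ.- ΣFin (suc k) (λ j → F r ((k + 2) ∸ toℕ j) ℤ.* lookup v j))

p : ℕ → ℕ → ℤ
p r k = last (pVec r k)

q : ℕ → ℕ → ℤ
q r i = p r ((r + 2) ∸ i)

-- square matrices, 0-based indices
Mat : ℕ → Set
Mat n = Fin n → Fin n → ℤ

_⊗_ : ∀ {n} → Mat n → Mat n → Mat n
_⊗_ {n} A B i j = ΣFin n (λ k → A i k ℤ.* B k j)

idMat : ∀ {n} → Mat n
idMat i j with toℕ i ≟ toℕ j
... | yes _ = + 1
... | no _ = + 0

_^ᴹ_ : ∀ {n} → Mat n → ℕ → Mat n
M ^ᴹ zero = idMat
M ^ᴹ suc e = M ⊗ (M ^ᴹ e)

-- Q_{r+2}: with 0-based indices i,j ∈ {0..r+1}: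
-- rows i ≤ r: entry 1 at column i+1, 0 elsewhere;
-- last row i = r+1: entry q_{j+1}.
Qmat : (r : ℕ) → Mat (r + 2)
Qmat r i j with toℕ i ≟ suc r
... | yes _ = q r (suc (toℕ j))
... | no _ with suc (toℕ i) ≟ toℕ j
...   | yes _ = + 1
...   | no _ = + 0

-- A_{r,n}: (1-based) entry (i,j) is F^(r)_{n+i+j-2}; 0-based: F^(r)_{n+i+j}
Amat : (r n : ℕ) → Mat (r + 2)
Amat r n i j = F r (n + toℕ i + toℕ j)

-- The generating function of F^(r) is x / ((1 - x - x²)(1 - x)^r). Writing d for the
-- coefficients of the denominator, d ⋆ F^(r) = x as power series. The coefficients of
-- x², …, x^(r+2) on the left vanish, which is exactly the recursion defining the q_i, so
-- q_i = -d_(r+3-i). The coefficients from x^(r+3) on vanish as well, and since d has degree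
-- r + 2 this is a linear recurrence of order r + 2 with companion matrix Q_(r+2). Hence
-- Q_(r+2) A_(r,n) = A_(r,n+1): the last row is the recurrence, the other rows shift A_(r,n)
-- up by one. Iterating gives the theorem.
module Submission where

open import Defs
open import Data.Nat as ℕ using (ℕ; zero; suc; _+_; _∸_; _≤_; _<_; s≤s)
import Data.Nat.Properties as ℕP
import Data.Nat.Tactic.RingSolver as ℕ-Solver
open import Data.Integer as ℤ using (ℤ; +_; 0ℤ; 1ℤ; -1ℤ; -_; _*_; _-_)
import Data.Integer.Properties as ℤP
open import Data.Integer.Tactic.RingSolver using (solve-∀)
open import Algebra.Properties.Semiring.Sum ℤP.+-*-semiring
  using (sum; sum-syntax; sum-cong-≗; sum-init-last; sum-replicate-zero;
         ∑-distrib-+; ∑-comm; ∑-permute; *-distribˡ-sum; *-distribʳ-sum)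
open import Data.Fin as Fin using (Fin; toℕ; fromℕ<)
open import Data.Fin.Properties using (toℕ<n; toℕ-inject₁; toℕ-fromℕ; toℕ-fromℕ<; opposite-prop)
import Data.Fin.Permutation as Perm
open import Data.Vec using (Vec; []; _∷_; _∷ʳ_; lookup)
open import Data.Vec.Properties using (last-∷ʳ)
open import Data.List using ([_]; _++_; map; upTo)
open import Data.List.Properties using (applyUpTo-∷ʳ; map-++)
import Data.Nat.ListAction as ℕL
open import Data.Nat.ListAction.Properties using (sum-++)
open import Data.Empty using (⊥-elim)
open import Function using (_∘_; id)
open import Relation.Nullary using (¬_; Dec; yes; no)
open import Relation.Binary.PropositionalEquality using (_≡_; refl; sym; trans; cong; cong₂; subst; module ≡-Reasoning)
open ≡-Reasoning

-- Finite sums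

ΣFin≡sum : ∀ n (f : Fin n → ℤ) → ΣFin n f ≡ sum f
ΣFin≡sum zero    f = refl
ΣFin≡sum (suc n) f = cong (ℤ._+_ (f Fin.zero)) (ΣFin≡sum n (f ∘ Fin.suc))

sumTo : ℕ → (ℕ → ℤ) → ℤ
sumTo n h = ∑[ i < n ] h (toℕ i)

sumTo-cong : ∀ n {g h : ℕ → ℤ} → (∀ i → i < n → g i ≡ h i) → sumTo n g ≡ sumTo n h
sumTo-cong n g≡h = sum-cong-≗ (λ i → g≡h (toℕ i) (toℕ<n i))

sumTo-zero : ∀ n {h : ℕ → ℤ} → (∀ i → i < n → h i ≡ 0ℤ) → sumTo n h ≡ 0ℤ
sumTo-zero n h≡0 = trans (sumTo-cong n h≡0) (sum-replicate-zero n)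

sumTo-last : ∀ n (h : ℕ → ℤ) → sumTo (suc n) h ≡ sumTo n h ℤ.+ h n
sumTo-last n h = trans (sum-init-last {n} (h ∘ toℕ))
  (cong₂ ℤ._+_ (sum-cong-≗ {n} (cong h ∘ toℕ-inject₁)) (cong h (toℕ-fromℕ n)))

sumTo-+ : ∀ m k (h : ℕ → ℤ) → sumTo (m + k) h ≡ sumTo m h ℤ.+ sumTo k (λ i → h (m + i))
sumTo-+ zero    k h = sym (ℤP.+-identityˡ _)
sumTo-+ (suc m) k h =
  trans (cong (ℤ._+_ (h 0)) (sumTo-+ m k (h ∘ suc))) (sym (ℤP.+-assoc (h 0) _ _))

sumTo-truncate : ∀ {m n} (h : ℕ → ℤ) → m ≤ n → (∀ i → m ≤ i → h i ≡ 0ℤ) → sumTo n h ≡ sumTo m h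
sumTo-truncate {m} {n} h m≤n tail≡0 = begin
  sumTo n h                                      ≡⟨ cong (λ k → sumTo k h) (ℕP.m+[n∸m]≡n m≤n) ⟨
  sumTo (m + (n ∸ m)) h                          ≡⟨ sumTo-+ m (n ∸ m) h ⟩
  sumTo m h ℤ.+ sumTo (n ∸ m) (λ i → h (m + i))  ≡⟨ cong (ℤ._+_ (sumTo m h)) tail-sum≡0 ⟩
  sumTo m h ℤ.+ 0ℤ                               ≡⟨ ℤP.+-identityʳ _ ⟩
  sumTo m h                                      ∎
  where
  tail-sum≡0 : sumTo (n ∸ m) (λ i → h (m + i)) ≡ 0ℤ
  tail-sum≡0 = sumTo-zero (n ∸ m) (λ i _ → tail≡0 (m + i) (ℕP.m≤m+n m i))

sumTo-reverse : ∀ n (h : ℕ → ℤ) → sumTo n (λ i → h (n ∸ suc i)) ≡ sumTo n h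
sumTo-reverse n h =
  sym (trans (∑-permute {n} {n} (h ∘ toℕ) Perm.reverse) (sum-cong-≗ {n} (cong h ∘ opposite-prop)))

neg-sumTo : ∀ n (h : ℕ → ℤ) → - sumTo n h ≡ sumTo n (λ i → - h i)
neg-sumTo n h = begin
  - sumTo n h                        ≡⟨ ℤP.-1*i≡-i _ ⟨
  -1ℤ * sumTo n h                    ≡⟨ *-distribˡ-sum {n} -1ℤ (h ∘ toℕ) ⟩
  sumTo n (λ i → -1ℤ * h i)          ≡⟨ sum-cong-≗ {n} (ℤP.-1*i≡-i ∘ h ∘ toℕ) ⟩
  sumTo n (λ i → - h i)              ∎

sumTo-sub : ∀ n (g h : ℕ → ℤ) → sumTo n (λ i → g i - h i) ≡ sumTo n g - sumTo n h
sumTo-sub n g h =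
  trans (∑-distrib-+ {n} (g ∘ toℕ) (λ i → - h (toℕ i))) (cong (ℤ._+_ (sumTo n g)) (sym (neg-sumTo n h)))

-- Sequences ℕ → ℤ stand for formal power series: ⋆ is their product, shift is
-- multiplication by x and Δ multiplication by 1 - x.

_⋆_ : (ℕ → ℤ) → (ℕ → ℤ) → ℕ → ℤ
(a ⋆ b) n = sumTo (suc n) (λ i → a i * b (n ∸ i))

shift : (ℕ → ℤ) → ℕ → ℤ
shift a zero    = 0ℤ
shift a (suc i) = a i

Δ : (ℕ → ℤ) → ℕ → ℤ
Δ a i = a i - shift a i

⋆-congʳ : ∀ a {b c : ℕ → ℤ} → (∀ i → b i ≡ c i) → ∀ n → (a ⋆ b) n ≡ (a ⋆ c) n
⋆-congʳ a b≗c n = sumTo-cong (suc n) (λ i _ → cong (a i *_) (b≗c (n ∸ i)))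

shift-⋆ : ∀ a b n → (shift a ⋆ b) n ≡ (a ⋆ shift b) n
shift-⋆ a b zero = sym (trans (ℤP.+-identityʳ _) (ℤP.*-zeroʳ (a 0)))
shift-⋆ a b (suc n) = begin
  (shift a ⋆ b) (suc n)                                      ≡⟨ ℤP.+-identityˡ _ ⟩
  (a ⋆ b) n                                                  ≡⟨ sumTo-cong (suc n) shift-term ⟩
  sumTo (suc n) S                                            ≡⟨ ℤP.+-identityʳ _ ⟨
  sumTo (suc n) S ℤ.+ 0ℤ                                     ≡⟨ cong (ℤ._+_ (sumTo (suc n) S)) last-term ⟨
  sumTo (suc n) S ℤ.+ S (suc n)                              ≡⟨ sumTo-last (suc n) S ⟨
  (a ⋆ shift b) (suc n)                                      ∎
  where
  S : ℕ → ℤ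
  S i = a i * shift b (suc n ∸ i)
  shift-term : ∀ i → i < suc n → a i * b (n ∸ i) ≡ S i
  shift-term i i<1+n = cong (λ k → a i * shift b k) (sym (ℕP.+-∸-assoc 1 (ℕ.s≤s⁻¹ i<1+n)))
  last-term : S (suc n) ≡ 0ℤ
  last-term = trans (cong (λ k → a (suc n) * shift b k) (ℕP.n∸n≡0 n)) (ℤP.*-zeroʳ (a (suc n)))

Δ-⋆ : ∀ a b n → (Δ a ⋆ b) n ≡ (a ⋆ Δ b) n
Δ-⋆ a b n = begin
  (Δ a ⋆ b) n                                ≡⟨ sumTo-cong (suc n) (λ i _ → distribʳ (a i) (shift a i) (b (n ∸ i))) ⟩
  sumTo (suc n) (λ i → ab i - [sa]b i)       ≡⟨ sumTo-sub (suc n) ab [sa]b ⟩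
  (a ⋆ b) n - (shift a ⋆ b) n                ≡⟨ cong (_-_ ((a ⋆ b) n)) (shift-⋆ a b n) ⟩
  (a ⋆ b) n - (a ⋆ shift b) n                ≡⟨ sumTo-sub (suc n) ab a[sb] ⟨
  sumTo (suc n) (λ i → ab i - a[sb] i)       ≡⟨ sumTo-cong (suc n) (λ i _ → distribˡ (a i) (b (n ∸ i)) (shift b (n ∸ i))) ⟨
  (a ⋆ Δ b) n                                ∎
  where
  ab [sa]b a[sb] : ℕ → ℤ
  ab     i = a i * b (n ∸ i)
  [sa]b  i = shift a i * b (n ∸ i)
  a[sb]  i = a i * shift b (n ∸ i)
  distribʳ : ∀ x y z → (x - y) * z ≡ x * z - y * z
  distribʳ = solve-∀
  distribˡ : ∀ x y z → x * (y - z) ≡ x * y - x * z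
  distribˡ = solve-∀

⋆≡0⇒recursion : ∀ {c a : ℕ → ℤ} n → c 0 ≡ 1ℤ → (c ⋆ a) n ≡ 0ℤ →
  a n ≡ - sumTo n (λ i → c (suc i) * a (n ∸ suc i))
⋆≡0⇒recursion {c} {a} n c₀≡1 c⋆a≡0 = begin
  a n                         ≡⟨ isolate (a n) S ⟩
  1ℤ * a n ℤ.+ S - S          ≡⟨ cong (λ x → x * a n ℤ.+ S - S) c₀≡1 ⟨
  (c ⋆ a) n - S               ≡⟨ cong (_- S) c⋆a≡0 ⟩
  0ℤ - S                      ≡⟨ ℤP.+-identityˡ (- S) ⟩
  - S                         ∎
  where
  S = sumTo n (λ i → c (suc i) * a (n ∸ suc i))
  isolate : ∀ x s → x ≡ 1ℤ * x ℤ.+ s - s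
  isolate = solve-∀

⋆≡0⇒linear-recurrence : ∀ {c a : ℕ → ℤ} m N → c 0 ≡ 1ℤ → (∀ i → c (suc m + i) ≡ 0ℤ) →
  (c ⋆ a) (N + m) ≡ 0ℤ → a (N + m) ≡ sumTo m (λ k → - c (m ∸ k) * a (N + k))
⋆≡0⇒linear-recurrence {c} {a} m N c₀≡1 deg≤m c⋆a≡0 = begin
  a (N + m)                                          ≡⟨ ⋆≡0⇒recursion {c} {a} (N + m) c₀≡1 c⋆a≡0 ⟩
  - sumTo (N + m) T                                  ≡⟨ cong -_ (sumTo-truncate T (ℕP.m≤n+m m N) T-vanishes) ⟩
  - sumTo m T                                        ≡⟨ neg-sumTo m T ⟩
  sumTo m (λ i → - T i)                              ≡⟨ sumTo-cong m reindex ⟩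
  sumTo m (λ i → R (m ∸ suc i))                      ≡⟨ sumTo-reverse m R ⟩
  sumTo m R                                          ∎
  where
  T R : ℕ → ℤ
  T i = c (suc i) * a (N + m ∸ suc i)
  R k = - c (m ∸ k) * a (N + k)
  T-vanishes : ∀ i → m ≤ i → T i ≡ 0ℤ
  T-vanishes i m≤i = cong (_* a (N + m ∸ suc i))
    (trans (cong (c ∘ suc) (sym (ℕP.m+[n∸m]≡n m≤i))) (deg≤m (i ∸ m)))
  reindex : ∀ i → i < m → - T i ≡ R (m ∸ suc i)
  reindex i i<m = trans (ℤP.neg-distribˡ-* (c (suc i)) _)
    (cong₂ (λ j k → - c j * a k) (sym (ℕP.m∸[m∸n]≡n i<m)) (ℕP.+-∸-assoc N i<m))

-- Hyperfibonacci numbers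

hyp-zero : ∀ r → hyp r 0 ≡ 0
hyp-zero zero    = refl
hyp-zero (suc r) = trans (ℕP.+-identityʳ (hyp r 0)) (hyp-zero r)

hyp-one : ∀ r → hyp r 1 ≡ 1
hyp-one zero    = refl
hyp-one (suc r) = cong₂ _+_ (hyp-zero r) (trans (ℕP.+-identityʳ (hyp r 1)) (hyp-one r))

hyp-suc : ∀ r k → hyp (suc r) (suc k) ≡ hyp (suc r) k + hyp r (suc k)
hyp-suc r k = begin
  ℕL.sum (map (hyp r) (upTo (suc (suc k))))                     ≡⟨ cong (ℕL.sum ∘ map (hyp r)) (applyUpTo-∷ʳ id (suc k)) ⟨
  ℕL.sum (map (hyp r) (upTo (suc k) ++ [ suc k ]))              ≡⟨ cong ℕL.sum (map-++ (hyp r) (upTo (suc k)) _) ⟩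
  ℕL.sum (map (hyp r) (upTo (suc k)) ++ [ hyp r (suc k) ])      ≡⟨ sum-++ (map (hyp r) (upTo (suc k))) _ ⟩
  hyp (suc r) k + (hyp r (suc k) + 0)                           ≡⟨ cong (_+_ (hyp (suc r) k)) (ℕP.+-identityʳ _) ⟩
  hyp (suc r) k + hyp r (suc k)                                 ∎

F-zero : ∀ r → F r 0 ≡ 0ℤ
F-zero r = cong +_ (hyp-zero r)

F-one : ∀ r → F r 1 ≡ 1ℤ
F-one r = cong +_ (hyp-one r)

Δ-F : ∀ r n → Δ (F (suc r)) n ≡ F r n
Δ-F r zero    = trans (ℤP.+-identityʳ _) (trans (F-zero (suc r)) (sym (F-zero r)))
Δ-F r (suc n) = begin
  F (suc r) (suc n) - F (suc r) n
    ≡⟨ cong (_- F (suc r) n) (trans (cong +_ (hyp-suc r n)) (ℤP.pos-+ (hyp (suc r) n) (hyp r (suc n)))) ⟩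
  F (suc r) n ℤ.+ F r (suc n) - F (suc r) n      ≡⟨ cancel (F (suc r) n) (F r (suc n)) ⟩
  F r (suc n)                                    ∎
  where
  cancel : ∀ x y → x ℤ.+ y - x ≡ y
  cancel = solve-∀

-- Coefficients of (1 - x - x²)(1 - x)^r.
den : ℕ → ℕ → ℤ
den zero 0 = 1ℤ
den zero 1 = -1ℤ
den zero 2 = -1ℤ
den zero _ = 0ℤ
den (suc r) = Δ (den r)

den-zero : ∀ r → den r 0 ≡ 1ℤ
den-zero zero    = refl
den-zero (suc r) = trans (ℤP.+-identityʳ (den r 0)) (den-zero r)

den-vanishes : ∀ r i → den r (3 + r + i) ≡ 0ℤ
den-vanishes zero    i = refl
den-vanishes (suc r) i = cong₂ _-_
  (trans (cong (λ m → den r (3 + m)) (sym (ℕP.+-suc r i))) (den-vanishes r (suc i)))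
  (den-vanishes r i)

-- Kronecker delta; δ 1 is the power series x.
δ : ℕ → ℕ → ℤ
δ zero    zero    = 1ℤ
δ zero    (suc _) = 0ℤ
δ (suc _) zero    = 0ℤ
δ (suc m) (suc n) = δ m n

δ-≡ : ∀ {m n} → m ≡ n → δ m n ≡ 1ℤ
δ-≡ {zero}  refl = refl
δ-≡ {suc m} refl = δ-≡ {m} refl

δ-≢ : ∀ {m n} → ¬ m ≡ n → δ m n ≡ 0ℤ
δ-≢ {zero}  {zero}  m≢n = ⊥-elim (m≢n refl)
δ-≢ {zero}  {suc n} m≢n = refl
δ-≢ {suc m} {zero}  m≢n = refl
δ-≢ {suc m} {suc n} m≢n = δ-≢ (m≢n ∘ cong suc)

den-⋆-fib : ∀ n → (den 0 ⋆ F 0) n ≡ δ 1 n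
den-⋆-fib zero = refl
den-⋆-fib (suc zero) = refl
den-⋆-fib (suc (suc m)) = begin
  1ℤ * F 0 (2 + m) ℤ.+ (-1ℤ * F 0 (1 + m) ℤ.+ (-1ℤ * F 0 m ℤ.+ sumTo m (λ _ → 0ℤ)))
    ≡⟨ cong₂ (λ x y → 1ℤ * x ℤ.+ (-1ℤ * F 0 (1 + m) ℤ.+ (-1ℤ * F 0 m ℤ.+ y)))
             (ℤP.pos-+ (fib (suc m)) (fib m)) (sumTo-zero m (λ _ _ → refl)) ⟩
  1ℤ * (F 0 (1 + m) ℤ.+ F 0 m) ℤ.+ (-1ℤ * F 0 (1 + m) ℤ.+ (-1ℤ * F 0 m ℤ.+ 0ℤ))
    ≡⟨ collapse (F 0 (1 + m)) (F 0 m) ⟩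
  0ℤ ∎
  where
  collapse : ∀ x y → 1ℤ * (x ℤ.+ y) ℤ.+ (-1ℤ * x ℤ.+ (-1ℤ * y ℤ.+ 0ℤ)) ≡ 0ℤ
  collapse = solve-∀

den-⋆-hyp : ∀ r n → (den r ⋆ F r) n ≡ δ 1 n
den-⋆-hyp zero    n = den-⋆-fib n
den-⋆-hyp (suc r) n = begin
  (Δ (den r) ⋆ F (suc r)) n   ≡⟨ Δ-⋆ (den r) (F (suc r)) n ⟩
  (den r ⋆ Δ (F (suc r))) n   ≡⟨ ⋆-congʳ (den r) (Δ-F r) n ⟩
  (den r ⋆ F r) n             ≡⟨ den-⋆-hyp r n ⟩
  δ 1 n                       ∎

hyp-recursion : ∀ r m → F r (2 + m) ≡ - sumTo (suc m) (λ i → den r (suc i) * F r (suc m ∸ i))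
hyp-recursion r m = begin
  F r (2 + m)                    ≡⟨ ⋆≡0⇒recursion {den r} {F r} (2 + m) (den-zero r) (den-⋆-hyp r (2 + m)) ⟩
  - sumTo (2 + m) T              ≡⟨ cong -_ (sumTo-last (suc m) T) ⟩
  - (sumTo (suc m) T ℤ.+ T (suc m)) ≡⟨ cong (λ x → - (sumTo (suc m) T ℤ.+ x)) last-term ⟩
  - (sumTo (suc m) T ℤ.+ 0ℤ)     ≡⟨ cong -_ (ℤP.+-identityʳ _) ⟩
  - sumTo (suc m) T              ∎
  where
  T : ℕ → ℤ
  T i = den r (suc i) * F r (suc m ∸ i)
  last-term : T (suc m) ≡ 0ℤ
  last-term = trans (cong (λ k → den r (2 + m) * F r k) (ℕP.n∸n≡0 m))
    (trans (cong (den r (2 + m) *_) (F-zero r)) (ℤP.*-zeroʳ (den r (2 + m))))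

hyp-recurrence : ∀ r N → F r (N + (r + 2)) ≡ sumTo (r + 2) (λ k → - den r (r + 2 ∸ k) * F r (N + k))
hyp-recurrence r N =
  ⋆≡0⇒linear-recurrence {den r} {F r} (r + 2) N (den-zero r) den-degree
    (trans (den-⋆-hyp r (N + (r + 2))) (cong (δ 1) (index≥2 N r)))
  where
  den-degree : ∀ i → den r (suc (r + 2) + i) ≡ 0ℤ
  den-degree i = trans (cong (λ k → den r (suc k + i)) (ℕP.+-comm r 2)) (den-vanishes r i)
  index≥2 : ∀ a b → a + (b + 2) ≡ 2 + (a + b)
  index≥2 = ℕ-Solver.solve-∀

-- The coefficients q_i

lookup-∷ʳ : ∀ {a} {A : Set a} {n} (v : Vec A n) x (h : ℕ → A) →
  (∀ j → lookup v j ≡ h (toℕ j)) → x ≡ h n → ∀ j → lookup (v ∷ʳ x) j ≡ h (toℕ j)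
lookup-∷ʳ []      x h v≗h x≡h Fin.zero    = x≡h
lookup-∷ʳ (y ∷ v) x h v≗h x≡h Fin.zero    = v≗h Fin.zero
lookup-∷ʳ (y ∷ v) x h v≗h x≡h (Fin.suc j) = lookup-∷ʳ v x (h ∘ suc) (v≗h ∘ Fin.suc) x≡h j

p-zero : ∀ r → p r 0 ≡ - den r 1
p-zero r = begin
  F r 2                        ≡⟨ hyp-recursion r 0 ⟩
  - (den r 1 * F r 1 ℤ.+ 0ℤ)   ≡⟨ cong (λ x → - (den r 1 * x ℤ.+ 0ℤ)) (F-one r) ⟩
  - (den r 1 * 1ℤ ℤ.+ 0ℤ)      ≡⟨ cong -_ (trans (ℤP.+-identityʳ _) (ℤP.*-identityʳ (den r 1))) ⟩
  - den r 1                    ∎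

pVec-next-entry : ∀ r k → (∀ j → lookup (pVec r k) j ≡ - den r (suc (toℕ j))) →
  F r (k + 3) - ΣFin (suc k) (λ j → F r ((k + 2) ∸ toℕ j) * lookup (pVec r k) j) ≡ - den r (2 + k)
pVec-next-entry r k pVec≗den = begin
  F r (k + 3) - ΣFin (suc k) (λ j → F r ((k + 2) ∸ toℕ j) * lookup (pVec r k) j)
    ≡⟨ cong₂ _-_ F-term Σ-term ⟩
  - (S ℤ.+ D * 1ℤ) - - S
    ≡⟨ cancel S D ⟩
  - D ∎
  where
  T : ℕ → ℤ
  T i = den r (suc i) * F r (suc (suc k) ∸ i)
  S = sumTo (suc k) T
  D = den r (2 + k)
  cancel : ∀ s d → - (s ℤ.+ d * 1ℤ) - - s ≡ - d
  cancel = solve-∀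
  swap-neg : ∀ x y → x * - y ≡ - (y * x)
  swap-neg = solve-∀
  F-term : F r (k + 3) ≡ - (S ℤ.+ D * 1ℤ)
  F-term = begin
    F r (k + 3)                          ≡⟨ cong (F r) (ℕP.+-comm k 3) ⟩
    F r (3 + k)                          ≡⟨ hyp-recursion r (suc k) ⟩
    - sumTo (2 + k) T                    ≡⟨ cong -_ (sumTo-last (suc k) T) ⟩
    - (S ℤ.+ D * F r (suc k ∸ k))        ≡⟨ cong (λ i → - (S ℤ.+ D * F r i)) (ℕP.m+n∸n≡m 1 k) ⟩
    - (S ℤ.+ D * F r 1)                  ≡⟨ cong (λ x → - (S ℤ.+ D * x)) (F-one r) ⟩
    - (S ℤ.+ D * 1ℤ)                     ∎
  Σ-term : ΣFin (suc k) (λ j → F r ((k + 2) ∸ toℕ j) * lookup (pVec r k) j) ≡ - S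
  Σ-term = begin
    ΣFin (suc k) (λ j → F r ((k + 2) ∸ toℕ j) * lookup (pVec r k) j)
      ≡⟨ ΣFin≡sum (suc k) (λ j → F r ((k + 2) ∸ toℕ j) * lookup (pVec r k) j) ⟩
    sum (λ j → F r ((k + 2) ∸ toℕ j) * lookup (pVec r k) j)
      ≡⟨ sum-cong-≗ (λ j → cong₂ (λ n x → F r (n ∸ toℕ j) * x) (ℕP.+-comm k 2) (pVec≗den j)) ⟩
    sumTo (suc k) (λ i → F r (2 + k ∸ i) * - den r (suc i))
      ≡⟨ sumTo-cong (suc k) (λ i _ → swap-neg (F r (2 + k ∸ i)) (den r (suc i))) ⟩
    sumTo (suc k) (λ i → - T i)
      ≡⟨ neg-sumTo (suc k) T ⟨
    - S ∎

pVec-lookup : ∀ r k (j : Fin (suc k)) → lookup (pVec r k) j ≡ - den r (suc (toℕ j))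
pVec-lookup r zero    Fin.zero = p-zero r
pVec-lookup r (suc k) =
  lookup-∷ʳ (pVec r k) _ (λ i → - den r (suc i)) (pVec-lookup r k) (pVec-next-entry r k (pVec-lookup r k))

p-den : ∀ r k → p r k ≡ - den r (suc k)
p-den r zero    = p-zero r
p-den r (suc k) = trans (last-∷ʳ _ (pVec r k)) (pVec-next-entry r k (pVec-lookup r k))

q-den : ∀ r k → k < r + 2 → q r (suc k) ≡ - den r (r + 2 ∸ k)
q-den r k k<r+2 = trans (p-den r (r + 2 ∸ suc k)) (cong (-_ ∘ den r) (sym (ℕP.+-∸-assoc 1 k<r+2)))

-- Matrices

⊗-assoc : ∀ {n} (A B C : Mat n) i j → ((A ⊗ B) ⊗ C) i j ≡ (A ⊗ (B ⊗ C)) i j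
⊗-assoc {n} A B C i j = begin
  ((A ⊗ B) ⊗ C) i j
    ≡⟨ trans (ΣFin≡sum n _) (sum-cong-≗ (λ k → cong (_* C k j) (ΣFin≡sum n _))) ⟩
  ∑[ k < n ] ((∑[ l < n ] (A i l * B l k)) * C k j)
    ≡⟨ sum-cong-≗ (λ k → *-distribʳ-sum (C k j) (λ l → A i l * B l k)) ⟩
  ∑[ k < n ] ∑[ l < n ] (A i l * B l k * C k j)
    ≡⟨ ∑-comm (λ k l → A i l * B l k * C k j) ⟩
  ∑[ l < n ] ∑[ k < n ] (A i l * B l k * C k j)
    ≡⟨ sum-cong-≗ (λ l → sum-cong-≗ (λ k → ℤP.*-assoc (A i l) (B l k) (C k j))) ⟩
  ∑[ l < n ] ∑[ k < n ] (A i l * (B l k * C k j))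
    ≡⟨ sum-cong-≗ (λ l → *-distribˡ-sum (A i l) (λ k → B l k * C k j)) ⟨
  ∑[ l < n ] (A i l * ∑[ k < n ] (B l k * C k j))
    ≡⟨ trans (ΣFin≡sum n _) (sum-cong-≗ (λ l → cong (A i l *_) (ΣFin≡sum n (λ k → B l k * C k j)))) ⟨
  (A ⊗ (B ⊗ C)) i j ∎

⊗-congʳ : ∀ {n} (A : Mat n) {B C : Mat n} → (∀ k j → B k j ≡ C k j) → ∀ i j → (A ⊗ B) i j ≡ (A ⊗ C) i j
⊗-congʳ {n} A {B} {C} B≗C i j = begin
  (A ⊗ B) i j                  ≡⟨ ΣFin≡sum n _ ⟩
  ∑[ k < n ] (A i k * B k j)   ≡⟨ sum-cong-≗ (λ k → cong (A i k *_) (B≗C k j)) ⟩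
  ∑[ k < n ] (A i k * C k j)   ≡⟨ ΣFin≡sum n _ ⟨
  (A ⊗ C) i j                  ∎

sum-δ : ∀ {n} (i : Fin n) (f : Fin n → ℤ) → ∑[ k < n ] (δ (toℕ i) (toℕ k) * f k) ≡ f i
sum-δ {suc n} Fin.zero    f = trans (cong₂ ℤ._+_ (ℤP.*-identityˡ (f Fin.zero)) (sum-replicate-zero n))
                                    (ℤP.+-identityʳ (f Fin.zero))
sum-δ {suc n} (Fin.suc i) f = trans (ℤP.+-identityˡ _) (sum-δ i (f ∘ Fin.suc))

sumTo-δ : ∀ {n t} → t < n → (h : ℕ → ℤ) → sumTo n (λ k → δ t k * h k) ≡ h t
sumTo-δ {n} t<n h =
  subst (λ t → sumTo n (λ k → δ t k * h k) ≡ h t) (toℕ-fromℕ< t<n) (sum-δ (fromℕ< t<n) (h ∘ toℕ))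

idMat-δ : ∀ {n} (i k : Fin n) → idMat i k ≡ δ (toℕ i) (toℕ k)
idMat-δ i k with toℕ i ℕ.≟ toℕ k
... | yes i≡k = sym (δ-≡ i≡k)
... | no  i≢k = sym (δ-≢ i≢k)

⊗-identityˡ : ∀ {n} (B : Mat n) i j → (idMat ⊗ B) i j ≡ B i j
⊗-identityˡ {n} B i j = begin
  (idMat ⊗ B) i j                          ≡⟨ ΣFin≡sum n _ ⟩
  ∑[ k < n ] (idMat i k * B k j)           ≡⟨ sum-cong-≗ (λ k → cong (_* B k j) (idMat-δ i k)) ⟩
  ∑[ k < n ] (δ (toℕ i) (toℕ k) * B k j)   ≡⟨ sum-δ i (λ k → B k j) ⟩
  B i j                                    ∎

⊗-iterate : ∀ {n} {M : Mat n} {A : ℕ → Mat n} → (∀ m i j → (M ⊗ A m) i j ≡ A (suc m) i j) →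
  ∀ m i j → A m i j ≡ ((M ^ᴹ m) ⊗ A 0) i j
⊗-iterate {A = A} step zero    i j = sym (⊗-identityˡ (A 0) i j)
⊗-iterate {M = M} {A} step (suc m) i j = begin
  A (suc m) i j                    ≡⟨ step m i j ⟨
  (M ⊗ A m) i j                    ≡⟨ ⊗-congʳ M (⊗-iterate step m) i j ⟩
  (M ⊗ ((M ^ᴹ m) ⊗ A 0)) i j       ≡⟨ ⊗-assoc M (M ^ᴹ m) (A 0) i j ⟨
  ((M ^ᴹ suc m) ⊗ A 0) i j         ∎

Qmat-last-row : ∀ r (i k : Fin (r + 2)) → toℕ i ≡ suc r → Qmat r i k ≡ q r (suc (toℕ k))
Qmat-last-row r i k i≡last with toℕ i ℕ.≟ suc r
... | yes _      = refl
... | no  i≢last = ⊥-elim (i≢last i≡last)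

Qmat-shift-row : ∀ r (i k : Fin (r + 2)) → ¬ toℕ i ≡ suc r → Qmat r i k ≡ δ (suc (toℕ i)) (toℕ k)
Qmat-shift-row r i k i≢last with toℕ i ℕ.≟ suc r
... | yes i≡last = ⊥-elim (i≢last i≡last)
... | no  _ with suc (toℕ i) ℕ.≟ toℕ k
...   | yes i+1≡k = sym (δ-≡ i+1≡k)
...   | no  i+1≢k = sym (δ-≢ i+1≢k)

Qmat-⊗-Amat-last-row : ∀ r n (i j : Fin (r + 2)) → toℕ i ≡ suc r →
  (Qmat r ⊗ Amat r n) i j ≡ Amat r (suc n) i j
Qmat-⊗-Amat-last-row r n i j i≡last = begin
  (Qmat r ⊗ Amat r n) i j                                   ≡⟨ ΣFin≡sum (r + 2) _ ⟩
  ∑[ k < r + 2 ] (Qmat r i k * F r (n + toℕ k + toℕ j))       ≡⟨ sum-cong-≗ recurrence-term ⟩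
  sumTo (r + 2) (λ k → - den r (r + 2 ∸ k) * F r (n + toℕ j + k))
                                                            ≡⟨ hyp-recurrence r (n + toℕ j) ⟨
  F r (n + toℕ j + (r + 2))                                 ≡⟨ cong (F r) (last-index (toℕ j)) ⟩
  F r (suc n + toℕ i + toℕ j)                               ∎
  where
  +-swap-last : ∀ a b c → a + b + c ≡ a + c + b
  +-swap-last = ℕ-Solver.solve-∀
  recurrence-term : ∀ k → Qmat r i k * F r (n + toℕ k + toℕ j) ≡ - den r (r + 2 ∸ toℕ k) * F r (n + toℕ j + toℕ k)
  recurrence-term k = cong₂ _*_ (trans (Qmat-last-row r i k i≡last) (q-den r (toℕ k) (toℕ<n k)))
                                (cong (F r) (+-swap-last n (toℕ k) (toℕ j)))
  last-row-index : ∀ a b c → a + c + (b + 2) ≡ suc a + suc b + c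
  last-row-index = ℕ-Solver.solve-∀
  last-index : ∀ j → n + j + (r + 2) ≡ suc n + toℕ i + j
  last-index j = trans (last-row-index n r j) (cong (λ t → suc n + t + j) (sym i≡last))

Qmat-⊗-Amat-shift-row : ∀ r n (i j : Fin (r + 2)) → ¬ toℕ i ≡ suc r →
  (Qmat r ⊗ Amat r n) i j ≡ Amat r (suc n) i j
Qmat-⊗-Amat-shift-row r n i j i≢last = begin
  (Qmat r ⊗ Amat r n) i j                                   ≡⟨ ΣFin≡sum (r + 2) _ ⟩
  ∑[ k < r + 2 ] (Qmat r i k * F r (n + toℕ k + toℕ j))
    ≡⟨ sum-cong-≗ (λ k → cong (_* F r (n + toℕ k + toℕ j)) (Qmat-shift-row r i k i≢last)) ⟩
  sumTo (r + 2) (λ k → δ (suc (toℕ i)) k * F r (n + k + toℕ j))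
                                                            ≡⟨ sumTo-δ below-last (λ k → F r (n + k + toℕ j)) ⟩
  F r (n + suc (toℕ i) + toℕ j)                             ≡⟨ cong (λ m → F r (m + toℕ j)) (ℕP.+-suc n (toℕ i)) ⟩
  F r (suc n + toℕ i + toℕ j)                               ∎
  where
  r+2≡ : r + 2 ≡ suc (suc r)
  r+2≡ = ℕP.+-comm r 2
  below-last : suc (toℕ i) < r + 2
  below-last = subst (suc (toℕ i) <_) (sym r+2≡)
    (s≤s (ℕP.≤∧≢⇒< (ℕ.s≤s⁻¹ (subst (toℕ i <_) r+2≡ (toℕ<n i))) i≢last))

Qmat-⊗-Amat : ∀ r n (i j : Fin (r + 2)) → (Qmat r ⊗ Amat r n) i j ≡ Amat r (suc n) i j
Qmat-⊗-Amat r n i j = by-row (toℕ i ℕ.≟ suc r)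
  where
  by-row : Dec (toℕ i ≡ suc r) → (Qmat r ⊗ Amat r n) i j ≡ Amat r (suc n) i j
  by-row (yes i≡last) = Qmat-⊗-Amat-last-row r n i j i≡last
  by-row (no  i≢last) = Qmat-⊗-Amat-shift-row r n i j i≢last

-- The identity holds for r = 0 as well.
theorem1 : (r : ℕ) → 1 ≤ r → (n : ℕ) → (i j : Fin (r + 2)) →
    Amat r n i j ≡ ((Qmat r ^ᴹ n) ⊗ Amat r 0) i j
theorem1 r _ = ⊗-iterate (Qmat-⊗-Amat r)
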